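{- Let $m\ge1$ and $N$ be positive integers such that $p^s-1$ divides $N$ and $V_m(N)$ is not empty. If $X$ is either an optimal or the greedy composition in $V_m(N)$, then $(m-1)N<wt(X)\le mN$.
   Context: Let $p$ be a prime, $s\ge1$. $V_m(N)$ is the set of $m$-tuples $(X_1,\dots,X_m)$ of positive integers summing to $N$ with no carryover of $p$-adic digits in the sum and with $(p^s-1)\mid X_j$ for $1\le j\le m-1$. $wt(X)=X_1+2X_2+\dots+mX_m$; optimal means of maximal weight in $V_m(N)$; the greedy element is the $(G_1,\dots,G_m)\in V_m(N)$ with $(G_m,\dots,G_1)$ lexicographically largest. -}

module Defs where

open import Data.Nat using (ℕ; zero; suc; _+_; _*_; _∸_; _^_; _≤_; _<_)
open import Data.Nat.DivMod using (_/_; _%_)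
open import Data.Nat.Divisibility using (_∣_)
open import Data.Fin as F using (Fin; toℕ)
open import Data.Product using (Σ; _×_; _,_)
open import Data.Sum using (_⊎_)
open import Relation.Binary.PropositionalEquality using (_≡_)

-- A composition with m parts: X : Fin m → ℕ, where the index i : Fin m
-- corresponds to the part X_{toℕ i + 1}.

sumF : (m : ℕ) → (Fin m → ℕ) → ℕ
sumF zero    f = 0
sumF (suc m) f = f F.zero + sumF m (λ i → f (F.suc i))


-- k-th base-p digit of x (digit k x = ⌊x / p^k⌋ mod p); p = 0 is irrelevant.
digit : (p k x : ℕ) → ℕ
digit zero    k       x = 0
digit (suc q) zero    x = x % suc q
digit (suc q) (suc k) x = digit (suc q) k (x / suc q)

NoCarry : (p m : ℕ) → (Fin m → ℕ) → Set
NoCarry p m X = ∀ (k : ℕ) → sumF m (λ i → digit p k (X i)) < p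

InV : (p s m N : ℕ) → (Fin m → ℕ) → Set
InV p s m N X =
  (∀ (i : Fin m) → 1 ≤ X i)
  × sumF m X ≡ N
  × NoCarry p m X
  × (∀ (i : Fin m) → suc (toℕ i) < m → (p ^ s ∸ 1) ∣ X i)

wt : (m : ℕ) → (Fin m → ℕ) → ℕ
wt m X = sumF m (λ i → suc (toℕ i) * X i)

Optimal : (p s m N : ℕ) → (Fin m → ℕ) → Set
Optimal p s m N X = InV p s m N X × (∀ Y → InV p s m N Y → wt m Y ≤ wt m X)

-- Y ≤ X in the lexicographic order of the reversed tuples (X_m, …, X_1):
-- either equal, or there is an index k with Y_i = X_i for all i > k and Y_k < X_k.
RevLex≤ : (m : ℕ) → (Fin m → ℕ) → (Fin m → ℕ) → Set
RevLex≤ m Y X =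
  (∀ i → Y i ≡ X i)
  ⊎ Σ (Fin m) (λ k → (∀ i → toℕ k < toℕ i → Y i ≡ X i) × Y k < X k)

Greedy : (p s m N : ℕ) → (Fin m → ℕ) → Set
Greedy p s m N G = InV p s m N G × (∀ Y → InV p s m N Y → RevLex≤ m Y G)

-- Let q = p^s − 1; since q ∣ N, every part of X is divisible by q.  If for some j < l the
-- sum X_j + X_l had a base-p submask Z with q ∣ Z and 0 < Z < X_j, replacing (X_j, X_l) by
-- (Z, X_j + X_l − Z) would stay in V_m(N) and increase both the weight and the reversed
-- lexicographic order, so no such Z exists.  As p^t ≡ p^(t mod s) (mod q), such a Z can be
-- built from the lower digits whenever X_j and X_l have the same number of digits; hence the
-- number of digits increases strictly along X, and for p = 2 a refinement gives X_l ≥ 2 X_j.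
-- This growth forces Σ_{i<m} (m − 1 − i) X_i < X_m, which is (m − 1) N < wt X; the bound
-- wt X ≤ m N is immediate.

{-# OPTIONS --safe #-}
module Submission where

open import Defs
open import Data.Nat
open import Data.Nat.Properties
open import Data.Nat.DivMod
open import Data.Nat.Divisibility using (_∣_; divides; ∣m+n∣m⇒∣n; ∣m∣n⇒∣m+n; n∣m*n; 1∣_)
open import Data.Nat.Induction using (<-wellFounded)
open import Data.Nat.Primality using (Prime; ¬prime[0]; ¬prime[1])
open import Data.Nat.Tactic.RingSolver using (solve-∀)
open import Data.Fin as F using (Fin; toℕ; fromℕ<)
open import Data.Fin.Properties as Fin using (toℕ-injective; toℕ<n; toℕ-fromℕ<)
open import Data.Vec.Functional using (updateAt)
open import Data.Vec.Functional.Properties using (updateAt-updates; updateAt-minimal)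
open import Data.Product using (Σ; ∃-syntax; _×_; _,_; proj₁; proj₂; uncurry)
open import Data.Sum using (_⊎_; inj₁; inj₂; [_,_]′)
open import Data.Empty using (⊥; ⊥-elim)
open import Function using (const; _∘_)
open import Induction.WellFounded using (Acc; acc)
open import Relation.Binary using (tri<; tri≈; tri>)
open import Relation.Binary.PropositionalEquality
open import Relation.Nullary using (yes; no; contradiction)

-- The base is p = 2 + k, so that p ≥ 2 and digit p reduces by pattern matching.
module Digits (k : ℕ) where

  p : ℕ
  p = 2 + k

  infix 4 _⊑_

  _⊑_ : ℕ → ℕ → Set
  z ⊑ y = ∀ i → digit p i z ≤ digit p i y

  CarryFree : ℕ → ℕ → Set
  CarryFree x y = ∀ i → digit p i x + digit p i y < p

  x≡x%p+p*[x/p] : ∀ x → x ≡ x % p + p * (x / p)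
  x≡x%p+p*[x/p] x = trans (m≡m%n+[m/n]*n x p) (cong (x % p +_) (*-comm (x / p) p))

  [r+p*y]%p≡r : ∀ {r} y → r < p → (r + p * y) % p ≡ r
  [r+p*y]%p≡r {r} y r<p = begin
    (r + p * y) % p  ≡⟨ cong (λ t → (r + t) % p) (*-comm p y) ⟩
    (r + y * p) % p  ≡⟨ [m+kn]%n≡m%n r y p ⟩
    r % p            ≡⟨ m<n⇒m%n≡m r<p ⟩
    r                ∎
    where open ≡-Reasoning

  [r+p*y]/p≡y : ∀ {r} y → r < p → (r + p * y) / p ≡ y
  [r+p*y]/p≡y {r} y r<p = begin
    (r + p * y) / p    ≡⟨ +-distrib-/-∣ʳ r (divides y (*-comm p y)) ⟩
    r / p + p * y / p  ≡⟨ cong₂ _+_ (m<n⇒m/n≡0 r<p) (trans (cong (_/ p) (*-comm p y)) (m*n/n≡m y p)) ⟩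
    y                  ∎
    where open ≡-Reasoning

  digit<p : ∀ i x → digit p i x < p
  digit<p zero    x = m%n<n x p
  digit<p (suc i) x = digit<p i (x / p)

  digit-0 : ∀ i → digit p i 0 ≡ 0
  digit-0 zero    = refl
  digit-0 (suc i) = digit-0 i

  digit-+ : ∀ i {x y} → CarryFree x y → digit p i (x + y) ≡ digit p i x + digit p i y
  digit-+ zero    {x} {y} cf = trans (%-distribˡ-+ x y p) (m<n⇒m%n≡m (cf 0))
  digit-+ (suc i) {x} {y} cf = trans (cong (digit p i) (+-distrib-/ x y (cf 0))) (digit-+ i (λ j → cf (suc j)))

  x/p<x : ∀ x .{{_ : NonZero x}} → x / p < x
  x/p<x x = m/n<m x p (s≤s (s≤s z≤n))

  ⊑-refl : ∀ {x} → x ⊑ x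
  ⊑-refl i = ≤-refl

  ⊑-trans : ∀ {x y z} → x ⊑ y → y ⊑ z → x ⊑ z
  ⊑-trans x⊑y y⊑z i = ≤-trans (x⊑y i) (y⊑z i)

  0⊑ : ∀ {y} → 0 ⊑ y
  0⊑ {y} i = subst (_≤ digit p i y) (sym (digit-0 i)) z≤n

  ⊑-cons : ∀ {r z y} → r ≤ y % p → z ⊑ y / p → r + p * z ⊑ y
  ⊑-cons {r} {z} {y} r≤ z⊑ zero    = subst (_≤ y % p) (sym ([r+p*y]%p≡r z (≤-<-trans r≤ (m%n<n y p)))) r≤
  ⊑-cons {r} {z} {y} r≤ z⊑ (suc i) =
    subst (λ t → digit p i t ≤ _) (sym ([r+p*y]/p≡y z (≤-<-trans r≤ (m%n<n y p)))) (z⊑ i)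

  ⊑⇒≤ : ∀ {z y} → z ⊑ y → z ≤ y
  ⊑⇒≤ {z} = go z (<-wellFounded z)
    where
    go : ∀ z {y} → Acc _<_ z → z ⊑ y → z ≤ y
    go zero          _        _   = z≤n
    go z@(suc _) {y} (acc rs) z⊑y = begin
      z                   ≡⟨ x≡x%p+p*[x/p] z ⟩
      z % p + p * (z / p) ≤⟨ +-mono-≤ (z⊑y 0) (*-monoʳ-≤ p (go (z / p) (rs (x/p<x z)) (λ i → z⊑y (suc i)))) ⟩
      y % p + p * (y / p) ≡⟨ sym (x≡x%p+p*[x/p] y) ⟩
      y                   ∎
      where open ≤-Reasoning

  CarryFree-sym : ∀ {x y} → CarryFree x y → CarryFree y x
  CarryFree-sym {x} {y} cf i = subst (_< p) (+-comm (digit p i x) (digit p i y)) (cf i)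

  CarryFree-⊑ : ∀ {x x′ y y′} → x ⊑ x′ → y ⊑ y′ → CarryFree x′ y′ → CarryFree x y
  CarryFree-⊑ x⊑ y⊑ cf i = ≤-<-trans (+-mono-≤ (x⊑ i) (y⊑ i)) (cf i)

  ⊑-+ˡ : ∀ {x y} → CarryFree x y → x ⊑ x + y
  ⊑-+ˡ {x} {y} cf i = subst (digit p i x ≤_) (sym (digit-+ i cf)) (m≤m+n _ _)

  ⊑-+ʳ : ∀ {x y} → CarryFree x y → y ⊑ x + y
  ⊑-+ʳ {x} {y} cf i = subst (digit p i y ≤_) (sym (digit-+ i cf)) (m≤n+m _ _)

  +-mono-⊑ : ∀ {x x′ y y′} → x ⊑ x′ → y ⊑ y′ → CarryFree x′ y′ → x + y ⊑ x′ + y′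
  +-mono-⊑ x⊑ y⊑ cf i =
    subst₂ _≤_ (sym (digit-+ i (CarryFree-⊑ x⊑ y⊑ cf))) (sym (digit-+ i cf)) (+-mono-≤ (x⊑ i) (y⊑ i))

  ⊑⇒complement : ∀ {z y} → z ⊑ y → ∃[ w ] z + w ≡ y × CarryFree z w
  ⊑⇒complement {z} {y} = go y (<-wellFounded y)
    where
    go : ∀ y {z} → Acc _<_ y → z ⊑ y → ∃[ w ] z + w ≡ y × CarryFree z w
    go zero          _        z⊑0 with ⊑⇒≤ z⊑0
    ... | z≤n = 0 , refl , λ i → subst (λ d → d + d < p) (sym (digit-0 i)) (s≤s z≤n)
    go y@(suc _) {z} (acc rs) z⊑y with go (y / p) (rs (x/p<x y)) (λ i → z⊑y (suc i))
    ... | w′ , z/p+w′≡y/p , cf′ = w₀ + p * w′ , sum , carryFree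
      where
      w₀ = y % p ∸ z % p
      z%p+w₀≡y%p : z % p + w₀ ≡ y % p
      z%p+w₀≡y%p = m+[n∸m]≡n (z⊑y 0)
      w₀<p : w₀ < p
      w₀<p = ≤-<-trans (m∸n≤m (y % p) (z % p)) (m%n<n y p)
      sum : z + (w₀ + p * w′) ≡ y
      sum = begin
        z + (w₀ + p * w′)                      ≡⟨ cong (_+ (w₀ + p * w′)) (x≡x%p+p*[x/p] z) ⟩
        (z % p + p * (z / p)) + (w₀ + p * w′)  ≡⟨ shuffle (z % p) (z / p) w₀ w′ ⟩
        (z % p + w₀) + p * (z / p + w′)        ≡⟨ cong₂ (λ a b → a + p * b) z%p+w₀≡y%p z/p+w′≡y/p ⟩
        y % p + p * (y / p)                    ≡⟨ sym (x≡x%p+p*[x/p] y) ⟩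
        y                                      ∎
        where
        open ≡-Reasoning
        shuffle : ∀ a b c d → (a + p * b) + (c + p * d) ≡ (a + c) + p * (b + d)
        shuffle = solve-∀
      carryFree : CarryFree z (w₀ + p * w′)
      carryFree zero    = subst (λ d → z % p + d < p) (sym ([r+p*y]%p≡r w′ w₀<p))
                            (subst (_< p) (sym z%p+w₀≡y%p) (m%n<n y p))
      carryFree (suc i) = subst (λ t → digit p (suc i) z + digit p i t < p) (sym ([r+p*y]/p≡y w′ w₀<p)) (cf′ i)

  p^t-shift : ∀ t x₀ x₁ → x₀ + p ^ suc t * x₁ ≡ x₀ % p + p * (x₀ / p + p ^ t * x₁)
  p^t-shift t x₀ x₁ = trans (cong (_+ p ^ suc t * x₁) (x≡x%p+p*[x/p] x₀)) (reassoc p (x₀ % p) (x₀ / p) (p ^ t) x₁)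
    where
    reassoc : ∀ q a b P c → (a + q * b) + (q * P) * c ≡ a + q * (b + P * c)
    reassoc = solve-∀

  <p^suc⇒/p<p^ : ∀ {x} t → x < p ^ suc t → x / p < p ^ t
  <p^suc⇒/p<p^ {x} t x< = m<n*o⇒m/o<n {x} {p ^ t} {p} (subst (x <_) (*-comm p (p ^ t)) x<)

  digit-suc-shift : ∀ t i x₀ x₁ → digit p (suc i) (x₀ + p ^ suc t * x₁) ≡ digit p i (x₀ / p + p ^ t * x₁)
  digit-suc-shift t i x₀ x₁ = begin
    digit p i ((x₀ + p ^ suc t * x₁) / p)                ≡⟨ cong (λ y → digit p i (y / p)) (p^t-shift t x₀ x₁) ⟩
    digit p i ((x₀ % p + p * (x₀ / p + p ^ t * x₁)) / p) ≡⟨ cong (digit p i) ([r+p*y]/p≡y _ (m%n<n x₀ p)) ⟩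
    digit p i (x₀ / p + p ^ t * x₁)                      ∎
    where open ≡-Reasoning

  digit-low : ∀ {t} i {x₀} x₁ → i < t → x₀ < p ^ t → digit p i (x₀ + p ^ t * x₁) ≡ digit p i x₀
  digit-low {suc t} zero    {x₀} x₁ _ _ =
    trans (cong (_% p) (p^t-shift t x₀ x₁)) ([r+p*y]%p≡r (x₀ / p + p ^ t * x₁) (m%n<n x₀ p))
  digit-low {suc t} (suc i) {x₀} x₁ (s≤s i<t) x₀< =
    trans (digit-suc-shift t i x₀ x₁) (digit-low i x₁ i<t (<p^suc⇒/p<p^ t x₀<))

  digit-high : ∀ {t} i {x₀} x₁ → t ≤ i → x₀ < p ^ t → digit p i (x₀ + p ^ t * x₁) ≡ digit p (i ∸ t) x₁
  digit-high {zero}  i       {zero}  x₁ _ _ = cong (digit p i) (+-identityʳ x₁)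
  digit-high {zero}  i       {suc _} x₁ _ (s≤s ())
  digit-high {suc t} (suc i) {x₀}    x₁ (s≤s t≤i) x₀< =
    trans (digit-suc-shift t i x₀ x₁) (digit-high i x₁ t≤i (<p^suc⇒/p<p^ t x₀<))

  <p^⇒digit≡0 : ∀ {t x} i → x < p ^ t → t ≤ i → digit p i x ≡ 0
  <p^⇒digit≡0 {t} {x} i x< t≤i = begin
    digit p i x               ≡⟨ cong (digit p i) (sym (trans (cong (x +_) (*-zeroʳ (p ^ t))) (+-identityʳ x))) ⟩
    digit p i (x + p ^ t * 0) ≡⟨ digit-high i 0 t≤i x< ⟩
    digit p (i ∸ t) 0         ≡⟨ digit-0 (i ∸ t) ⟩
    0                         ∎
    where open ≡-Reasoning

  ⊑-block : ∀ {t z₀ z₁ y₀ y₁} → z₀ ⊑ y₀ → z₁ ⊑ y₁ → y₀ < p ^ t → z₀ + p ^ t * z₁ ⊑ y₀ + p ^ t * y₁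
  ⊑-block {t} {z₀} {z₁} {y₀} {y₁} z₀⊑ z₁⊑ y₀< i with i <? t
  ... | yes i<t = subst₂ _≤_ (sym (digit-low i z₁ i<t z₀<)) (sym (digit-low i y₁ i<t y₀<)) (z₀⊑ i)
    where z₀< = ≤-<-trans (⊑⇒≤ z₀⊑) y₀<
  ... | no i≮t  = subst₂ _≤_ (sym (digit-high i z₁ t≤i z₀<)) (sym (digit-high i y₁ t≤i y₀<)) (z₁⊑ (i ∸ t))
    where
    z₀< = ≤-<-trans (⊑⇒≤ z₀⊑) y₀<
    t≤i = ≮⇒≥ i≮t

  p^t∸1-digits : ∀ t → p ^ suc t ∸ 1 ≡ suc k + p * (p ^ t ∸ 1)
  p^t∸1-digits t with p ^ t | m^n>0 p t
  ... | suc P | _ = cong (_∸ 1) (*-suc p P)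

  digit-p^t∸1 : ∀ {t} i → i < t → digit p i (p ^ t ∸ 1) ≡ suc k
  digit-p^t∸1 {suc t} zero    _ = trans (cong (_% p) (p^t∸1-digits t)) ([r+p*y]%p≡r (p ^ t ∸ 1) ≤-refl)
  digit-p^t∸1 {suc t} (suc i) (s≤s i<t) =
    trans (cong (λ y → digit p i (y / p)) (p^t∸1-digits t))
      (trans (cong (digit p i) ([r+p*y]/p≡y (p ^ t ∸ 1) ≤-refl)) (digit-p^t∸1 i i<t))

  high-digits≡0⇒⊑p^∸1 : ∀ {t} x → (∀ i → t ≤ i → digit p i x ≡ 0) → x ⊑ p ^ t ∸ 1
  high-digits≡0⇒⊑p^∸1 {t} x high≡0 i with i <? t
  ... | yes i<t = subst (digit p i x ≤_) (sym (digit-p^t∸1 i i<t)) (≤-pred (digit<p i x))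
  ... | no i≮t  = subst (_≤ digit p i (p ^ t ∸ 1)) (sym (high≡0 i (≮⇒≥ i≮t))) z≤n

  <p^⇒⊑p^∸1 : ∀ {t x} → x < p ^ t → x ⊑ p ^ t ∸ 1
  <p^⇒⊑p^∸1 {t} {x} x< = high-digits≡0⇒⊑p^∸1 {t} x (λ i → <p^⇒digit≡0 i x<)

  high-digits≡0⇒<p^ : ∀ {t} x → (∀ i → t ≤ i → digit p i x ≡ 0) → x < p ^ t
  high-digits≡0⇒<p^ {t} x high≡0 = ≤p^∸1⇒<p^ (⊑⇒≤ (high-digits≡0⇒⊑p^∸1 x high≡0))
    where
    ≤p^∸1⇒<p^ : x ≤ p ^ t ∸ 1 → x < p ^ t
    ≤p^∸1⇒<p^ with p ^ t | m^n>0 p t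
    ... | suc P | _ = s≤s

  CarryFree⇒+<p^ : ∀ {t x y} → CarryFree x y → x < p ^ t → y < p ^ t → x + y < p ^ t
  CarryFree⇒+<p^ {t} {x} {y} cf x< y< = high-digits≡0⇒<p^ {t} (x + y) λ i t≤i → begin
    digit p i (x + y)             ≡⟨ digit-+ i cf ⟩
    digit p i x + digit p i y     ≡⟨ cong₂ _+_ (<p^⇒digit≡0 {t} i x< t≤i) (<p^⇒digit≡0 {t} i y< t≤i) ⟩
    0                             ∎
    where open ≡-Reasoning

  lowPart highPart : ℕ → ℕ → ℕ
  lowPart  t x = _%_ x (p ^ t) {{m^n≢0 p t}}
  highPart t x = _/_ x (p ^ t) {{m^n≢0 p t}}

  x≡low+p^t*high : ∀ t x → x ≡ lowPart t x + p ^ t * highPart t x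
  x≡low+p^t*high t x =
    trans (m≡m%n+[m/n]*n x (p ^ t) {{m^n≢0 p t}}) (cong (lowPart t x +_) (*-comm (highPart t x) (p ^ t)))

  lowPart<p^ : ∀ t x → lowPart t x < p ^ t
  lowPart<p^ t x = m%n<n x (p ^ t) {{m^n≢0 p t}}

  lowPart⊑ : ∀ t x → lowPart t x ⊑ x
  lowPart⊑ t x i with i <? t
  ... | yes i<t = ≤-reflexive (sym (trans (cong (digit p i) (x≡low+p^t*high t x))
                                         (digit-low i (highPart t x) i<t (lowPart<p^ t x))))
  ... | no i≮t  = subst (_≤ digit p i x) (sym (<p^⇒digit≡0 {t} i (lowPart<p^ t x) (≮⇒≥ i≮t))) z≤n

  digit≡highPart%p : ∀ t x → digit p t x ≡ highPart t x % p
  digit≡highPart%p t x = begin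
    digit p t x                                    ≡⟨ cong (digit p t) (x≡low+p^t*high t x) ⟩
    digit p t (lowPart t x + p ^ t * highPart t x) ≡⟨ digit-high t (highPart t x) ≤-refl (lowPart<p^ t x) ⟩
    digit p (t ∸ t) (highPart t x)                 ≡⟨ cong (λ i → digit p i (highPart t x)) (n∸n≡0 t) ⟩
    highPart t x % p                               ∎
    where open ≡-Reasoning

  p^t*c≤⇒≤highPart : ∀ t {x} c → p ^ t * c ≤ x → c ≤ highPart t x
  p^t*c≤⇒≤highPart t {x} c le = subst (_≤ highPart t x) (m*n/n≡m c (p ^ t) {{m^n≢0 p t}})
    (/-monoˡ-≤ (p ^ t) {{m^n≢0 p t}} (subst (_≤ x) (*-comm (p ^ t) c) le))

  <p^t*c⇒highPart< : ∀ t {x} c → x < p ^ t * c → highPart t x < c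
  <p^t*c⇒highPart< t {x} c lt = m<n*o⇒m/o<n {x} {c} {p ^ t} {{m^n≢0 p t}} (subst (x <_) (*-comm (p ^ t) c) lt)

  highPart-bounds : ∀ t {x} → p ^ t ≤ x → x < p ^ suc t → 1 ≤ highPart t x × highPart t x < p
  highPart-bounds t {x} p^t≤x x<p^t+1 =
    p^t*c≤⇒≤highPart t 1 (subst (_≤ x) (sym (*-identityʳ (p ^ t))) p^t≤x) ,
    <p^t*c⇒highPart< t p (subst (x <_) (*-comm p (p ^ t)) x<p^t+1)

  power-bracket : ∀ x → 0 < x → ∃[ t ] p ^ t ≤ x × x < p ^ suc t
  power-bracket x = go x (<-wellFounded x)
    where
    go : ∀ x → Acc _<_ x → 0 < x → ∃[ t ] p ^ t ≤ x × x < p ^ suc t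
    go x (acc rs) x>0 with x <? p
    ... | yes x<p = 0 , x>0 , subst (x <_) (sym (*-identityʳ p)) x<p
    ... | no x≮p with go (x / p) (rs (x/p<x x {{>-nonZero x>0}})) (m≥n⇒m/n>0 (≮⇒≥ x≮p))
    ... | t , lower , upper = suc t , lower′ , upper′
      where
      open ≤-Reasoning
      lower′ : p ^ suc t ≤ x
      lower′ = begin
        p * p ^ t            ≤⟨ *-monoʳ-≤ p lower ⟩
        p * (x / p)          ≤⟨ m≤n+m _ (x % p) ⟩
        x % p + p * (x / p)  ≡⟨ sym (x≡x%p+p*[x/p] x) ⟩
        x                    ∎
      upper′ : x < p ^ suc (suc t)
      upper′ = begin-strict
        x                    ≡⟨ x≡x%p+p*[x/p] x ⟩
        x % p + p * (x / p)  <⟨ +-monoˡ-< (p * (x / p)) (m%n<n x p) ⟩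
        p + p * (x / p)      ≡⟨ sym (*-suc p (x / p)) ⟩
        p * suc (x / p)      ≤⟨ *-monoʳ-≤ p upper ⟩
        p * p ^ suc t        ∎

  ⌊log⌋ : ℕ → ℕ
  ⌊log⌋ zero        = 0
  ⌊log⌋ x@(suc _)   = proj₁ (power-bracket x z<s)

  p^⌊log⌋≤ : ∀ {x} → 0 < x → p ^ ⌊log⌋ x ≤ x
  p^⌊log⌋≤ {suc x} _ = proj₁ (proj₂ (power-bracket (suc x) z<s))

  <p^suc⌊log⌋ : ∀ {x} → 0 < x → x < p ^ suc (⌊log⌋ x)
  <p^suc⌊log⌋ {suc x} _ = proj₂ (proj₂ (power-bracket (suc x) z<s))

  p^a≤y<p^suc[c]⇒a≤c : ∀ {a c y} → p ^ a ≤ y → y < p ^ suc c → a ≤ c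
  p^a≤y<p^suc[c]⇒a≤c {a} {c} lower upper with a ≤? c
  ... | yes a≤c = a≤c
  ... | no a≰c  = contradiction (≤-trans (^-monoʳ-≤ p (≰⇒> a≰c)) lower) (<⇒≱ upper)

  ≤-+-split : ∀ {t a b} → t ≤ a + b → ∃[ x ] ∃[ y ] x ≤ a × y ≤ b × t ≡ x + y
  ≤-+-split {t} {a} {b} t≤a+b with t ≤? a
  ... | yes t≤a = t , 0 , t≤a , z≤n , sym (+-identityʳ t)
  ... | no t≰a  = a , t ∸ a , ≤-refl , t∸a≤b , sym (m+[n∸m]≡n (<⇒≤ (≰⇒> t≰a)))
    where
    t∸a≤b : t ∸ a ≤ b
    t∸a≤b = ≤-trans (∸-monoˡ-≤ a t≤a+b) (≤-reflexive (m+n∸m≡n a b))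

  /p+/p< : ∀ A B → 0 < A + B → A / p + B / p < A + B
  /p+/p< zero    (suc B) _ = x/p<x (suc B)
  /p+/p< (suc A) B       _ = +-mono-<-≤ (x/p<x (suc A)) (m/n≤m B p)

  carry : ℕ → ℕ → ℕ → ℕ
  carry A B c = (A % p + B % p + c) / p

  carry≤1 : ∀ A B {c} → c ≤ 1 → carry A B c ≤ 1
  carry≤1 A B {c} c≤1 = ≤-pred (m<n*o⇒m/o<n {A % p + B % p + c} {2} {p} (begin-strict
    A % p + B % p + c  <⟨ +-mono-≤-< (+-mono-≤ (≤-pred (m%n<n A p)) (≤-pred (m%n<n B p))) (s≤s c≤1) ⟩
    suc k + suc k + 2  ≡⟨ twice (suc k) ⟩
    2 * p              ∎))
    where
    open ≤-Reasoning
    twice : ∀ n → n + n + 2 ≡ 2 * suc n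
    twice = solve-∀

  A+B+c-digits : ∀ A B c → A + B + c ≡ (A % p + B % p + c) % p + p * (A / p + B / p + carry A B c)
  A+B+c-digits A B c = begin
    A + B + c                                  ≡⟨ cong₂ (λ a b → a + b + c) (x≡x%p+p*[x/p] A) (x≡x%p+p*[x/p] B) ⟩
    (A % p + p * (A / p)) + (B % p + p * (B / p)) + c
                                               ≡⟨ regroup p (A % p) (B % p) c (A / p) (B / p) ⟩
    u + p * (A / p + B / p)                    ≡⟨ cong (_+ p * (A / p + B / p)) (x≡x%p+p*[x/p] u) ⟩
    (u % p + p * (u / p)) + p * (A / p + B / p) ≡⟨ regroup′ p (u % p) (u / p) (A / p + B / p) ⟩
    u % p + p * (A / p + B / p + u / p)        ∎
    where
    open ≡-Reasoning
    u = A % p + B % p + c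
    regroup : ∀ q a b c x y → (a + q * x) + (b + q * y) + c ≡ (a + b + c) + q * (x + y)
    regroup = solve-∀
    regroup′ : ∀ q r v w → (r + q * v) + q * w ≡ r + q * (w + v)
    regroup′ = solve-∀

  z/p⊑ : ∀ A B c {z} → z ⊑ A + B + c → z / p ⊑ A / p + B / p + carry A B c
  z/p⊑ A B c {z} z⊑ i = subst (λ y → digit p i (z / p) ≤ digit p i y) [A+B+c]/p≡ (z⊑ (suc i))
    where
    [A+B+c]/p≡ : (A + B + c) / p ≡ A / p + B / p + carry A B c
    [A+B+c]/p≡ = trans (cong (_/ p) (A+B+c-digits A B c))
                   ([r+p*y]/p≡y (A / p + B / p + carry A B c) (m%n<n (A % p + B % p + c) p))

  ⊑-+-split-extend : ∀ A B c {z x′ y′ e′} → z ⊑ A + B + c →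
                     x′ ⊑ A / p → y′ ⊑ B / p → e′ ≤ carry A B c → z / p ≡ x′ + y′ + e′ →
                     ∃[ x ] ∃[ y ] ∃[ e ] x ⊑ A × y ⊑ B × e ≤ c × z ≡ x + y + e
  ⊑-+-split-extend A B c {z} {x′} {y′} {e′} z⊑ x′⊑ y′⊑ e′≤ z/p≡
    with ≤-+-split {z % p + p * e′} {A % p} {B % p + c} bound
    where
    u = A % p + B % p + c
    z%p≤ : z % p ≤ u % p
    z%p≤ = subst (z % p ≤_) (trans (cong (_% p) (A+B+c-digits A B c)) ([r+p*y]%p≡r (A / p + B / p + carry A B c) (m%n<n u p)))
             (z⊑ 0)
    bound : z % p + p * e′ ≤ A % p + (B % p + c)
    bound = begin
      z % p + p * e′           ≤⟨ +-mono-≤ z%p≤ (*-monoʳ-≤ p e′≤) ⟩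
      u % p + p * carry A B c  ≡⟨ x≡x%p+p*[x/p] u ⟨
      u                        ≡⟨ +-assoc (A % p) (B % p) c ⟩
      A % p + (B % p + c)      ∎
      where open ≤-Reasoning
  ... | x₀ , r , x₀≤ , r≤ , z%p+pe′≡ with ≤-+-split {r} {B % p} {c} r≤
  ... | y₀ , e₀ , y₀≤ , e₀≤ , r≡ = x₀ + p * x′ , y₀ + p * y′ , e₀ , ⊑-cons x₀≤ x′⊑ , ⊑-cons y₀≤ y′⊑ , e₀≤ , z≡
    where
    z≡ : z ≡ x₀ + p * x′ + (y₀ + p * y′) + e₀
    z≡ = begin
      z                                   ≡⟨ x≡x%p+p*[x/p] z ⟩
      z % p + p * (z / p)                 ≡⟨ cong (λ w → z % p + p * w) z/p≡ ⟩
      z % p + p * (x′ + y′ + e′)          ≡⟨ regroup p (z % p) x′ y′ e′ ⟩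
      (z % p + p * e′) + p * x′ + p * y′  ≡⟨ cong (λ w → w + p * x′ + p * y′) (trans z%p+pe′≡ (cong (x₀ +_) r≡)) ⟩
      (x₀ + (y₀ + e₀)) + p * x′ + p * y′  ≡⟨ regroup′ p x₀ y₀ e₀ x′ y′ ⟩
      x₀ + p * x′ + (y₀ + p * y′) + e₀    ∎
      where
      open ≡-Reasoning
      regroup : ∀ q a x y e → a + q * (x + y + e) ≡ (a + q * e) + q * x + q * y
      regroup = solve-∀
      regroup′ : ∀ q a b e x y → (a + (b + e)) + q * x + q * y ≡ (a + q * x) + (b + q * y) + e
      regroup′ = solve-∀

  -- c is the carry coming into the lowest digit position.
  ⊑-+-carry-split : ∀ A B c {z} → Acc _<_ (A + B) → c ≤ 1 → z ⊑ A + B + c →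
                    ∃[ x ] ∃[ y ] ∃[ e ] x ⊑ A × y ⊑ B × e ≤ c × z ≡ x + y + e
  ⊑-+-carry-split A B c {z} (acc rs) c≤1 z⊑ with A + B ≟ 0
  ... | yes A+B≡0 = 0 , 0 , z , 0⊑ , 0⊑ , ⊑⇒≤ (subst (z ⊑_) (cong (_+ c) A+B≡0) z⊑) , refl
  ... | no A+B≢0
    with ⊑-+-carry-split (A / p) (B / p) (carry A B c) (rs (/p+/p< A B (n≢0⇒n>0 A+B≢0)))
                         (carry≤1 A B c≤1) (z/p⊑ A B c z⊑)
  ... | x′ , y′ , e′ , x′⊑ , y′⊑ , e′≤ , z/p≡ = ⊑-+-split-extend A B c z⊑ x′⊑ y′⊑ e′≤ z/p≡

  ⊑-+-split : ∀ {z A B} → z ⊑ A + B → ∃[ x ] ∃[ y ] x ⊑ A × y ⊑ B × z ≡ x + y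
  ⊑-+-split {z} {A} {B} z⊑
    with ⊑-+-carry-split A B 0 (<-wellFounded (A + B)) z≤n (subst (z ⊑_) (sym (+-identityʳ (A + B))) z⊑)
  ... | x , y , e , x⊑ , y⊑ , e≤0 , z≡ =
    x , y , x⊑ , y⊑ , trans z≡ (trans (cong (x + y +_) (n≤0⇒n≡0 e≤0)) (+-identityʳ (x + y)))

  digit-p^r*α : ∀ {r α} → α < p → digit p r (p ^ r * α) ≡ α
  digit-p^r*α {r} {α} α<p = begin
    digit p r (p ^ r * α)      ≡⟨ digit-high {r} r {0} α ≤-refl (m^n>0 p r) ⟩
    digit p (r ∸ r) α          ≡⟨ cong (λ i → digit p i α) (n∸n≡0 r) ⟩
    α % p                      ≡⟨ m<n⇒m%n≡m α<p ⟩
    α                          ∎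
    where open ≡-Reasoning

  digit-p^r*α-off : ∀ {r α} i → α < p → i ≢ r → digit p i (p ^ r * α) ≡ 0
  digit-p^r*α-off {r} {α} i α<p i≢r with <-cmp i r
  ... | tri< i<r _ _ = trans (digit-low {r} i {0} α i<r (m^n>0 p r)) (digit-0 i)
  ... | tri≈ _ i≡r _ = contradiction i≡r i≢r
  ... | tri> _ _ r<i with i ∸ r | m+[n∸m]≡n (<⇒≤ r<i) | digit-high {r} i {0} α (<⇒≤ r<i) (m^n>0 p r)
  ...   | zero  | r+0≡i | eq = contradiction (trans (sym (+-identityʳ r)) r+0≡i) (λ r≡i → i≢r (sym r≡i))
  ...   | suc j | _     | eq = trans eq (trans (cong (digit p j) (m<n⇒m/n≡0 α<p)) (digit-0 j))

  CarryFree-p^* : ∀ r r′ {α β} → α < p → β < p → (r ≡ r′ → α + β < p) → CarryFree (p ^ r * α) (p ^ r′ * β)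
  CarryFree-p^* r r′ {α} {β} α<p β<p same⇒α+β<p i with i ≟ r | i ≟ r′
  ... | yes refl | yes refl = subst (_< p) (sym (cong₂ _+_ (digit-p^r*α {r} α<p) (digit-p^r*α {r} β<p))) (same⇒α+β<p refl)
  ... | yes refl | no i≢r′  = subst (_< p) (sym (cong₂ _+_ (digit-p^r*α {r} α<p) (digit-p^r*α-off i β<p i≢r′)))
                                (subst (_< p) (sym (+-identityʳ α)) α<p)
  ... | no i≢r   | yes refl = subst (_< p) (sym (cong₂ _+_ (digit-p^r*α-off i α<p i≢r) (digit-p^r*α {r′} β<p))) β<p
  ... | no i≢r   | no i≢r′  = subst (_< p) (sym (cong₂ _+_ (digit-p^r*α-off i α<p i≢r) (digit-p^r*α-off i β<p i≢r′)))
                                (s≤s z≤n)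

  2+p^r≤p^[1+s] : ∀ {r s} → r ≤ s → 1 ≤ s → 2 + p ^ r ≤ p ^ suc s
  2+p^r≤p^[1+s] {r} {s} r≤s 1≤s = begin
    2 + p ^ r        ≤⟨ +-monoʳ-≤ 2 (^-monoʳ-≤ p r≤s) ⟩
    2 + p ^ s        ≤⟨ +-monoˡ-≤ (p ^ s) 2≤p^s ⟩
    p ^ s + p ^ s    ≡⟨ cong (p ^ s +_) (sym (+-identityʳ (p ^ s))) ⟩
    2 * p ^ s        ≤⟨ *-monoˡ-≤ (p ^ s) (s≤s (s≤s (z≤n {k}))) ⟩
    p * p ^ s        ∎
    where
    open ≤-Reasoning
    2≤p^s : 2 ≤ p ^ s
    2≤p^s = ≤-trans (≤-trans (s≤s (s≤s z≤n)) (≤-reflexive (sym (*-identityʳ p)))) (^-monoʳ-≤ p 1≤s)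

  module Modulus (s : ℕ) .{{_ : NonZero s}} where

    q : ℕ
    q = p ^ s ∸ 1

    p^s≡1+q : p ^ s ≡ suc q
    p^s≡1+q = sym (m+[n∸m]≡n (m^n>0 p s))

    q≥1 : 1 ≤ q
    q≥1 = ≤-pred (begin
      2      ≤⟨ s≤s (s≤s z≤n) ⟩
      p      ≡⟨ sym (*-identityʳ p) ⟩
      p ^ 1  ≤⟨ ^-monoʳ-≤ p (>-nonZero⁻¹ s) ⟩
      p ^ s  ≡⟨ p^s≡1+q ⟩
      suc q  ∎)
      where open ≤-Reasoning

    suc[t]%s≡ : ∀ {t} → suc t % s ≡ suc (t % s) % s
    suc[t]%s≡ {t} = trans (cong (λ n → suc n % s) (m≡m%n+[m/n]*n t s)) ([m+kn]%n≡m%n (suc (t % s)) (t / s) s)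

    suc-%s : ∀ t → (suc (t % s) < s × suc t % s ≡ suc (t % s)) ⊎ (suc (t % s) ≡ s × suc t % s ≡ 0)
    suc-%s t with suc (t % s) <? s
    ... | yes r+1<s = inj₁ (r+1<s , trans suc[t]%s≡ (m<n⇒m%n≡m r+1<s))
    ... | no r+1≮s  = inj₂ (r+1≡s , trans suc[t]%s≡ (trans (cong (_% s) r+1≡s) (n%n≡0 s)))
      where
      r+1≡s : suc (t % s) ≡ s
      r+1≡s = ≤-antisym (m%n<n t s) (≮⇒≥ r+1≮s)

    p^t≡p^[t%s]+e*q : ∀ t → ∃[ e ] p ^ t ≡ p ^ (t % s) + e * q
    p^t≡p^[t%s]+e*q zero    = 0 , cong (λ r → p ^ r + 0) (sym (m<n⇒m%n≡m (>-nonZero⁻¹ s)))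
    p^t≡p^[t%s]+e*q (suc t) with p^t≡p^[t%s]+e*q t
    ... | e , p^t≡ = reduce (suc-%s t)
      where
      p^[t+1]≡ : p ^ suc t ≡ p ^ suc (t % s) + (p * e) * q
      p^[t+1]≡ = trans (cong (p *_) p^t≡) (distrib p (p ^ (t % s)) e q)
        where
        distrib : ∀ p P e q → p * (P + e * q) ≡ p * P + (p * e) * q
        distrib = solve-∀
      reduce : (suc (t % s) < s × suc t % s ≡ suc (t % s)) ⊎ (suc (t % s) ≡ s × suc t % s ≡ 0) →
               ∃[ e′ ] p ^ suc t ≡ p ^ (suc t % s) + e′ * q
      reduce (inj₁ (_ , t+1%s≡)) = p * e , trans p^[t+1]≡ (cong (λ r → p ^ r + (p * e) * q) (sym t+1%s≡))
      reduce (inj₂ (r+1≡s , t+1%s≡)) = suc (p * e) , (begin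
        p ^ suc t                          ≡⟨ p^[t+1]≡ ⟩
        p ^ suc (t % s) + (p * e) * q      ≡⟨ cong (λ r → p ^ r + (p * e) * q) r+1≡s ⟩
        p ^ s + (p * e) * q                ≡⟨ cong (_+ (p * e) * q) p^s≡1+q ⟩
        suc q + (p * e) * q                ≡⟨ cong (λ r → p ^ r + suc (p * e) * q) (sym t+1%s≡) ⟩
        p ^ (suc t % s) + suc (p * e) * q  ∎)
        where open ≡-Reasoning

    suc[t]%s≢t%s : 2 ≤ s → ∀ t → suc t % s ≢ t % s
    suc[t]%s≢t%s 2≤s t with suc-%s t
    ... | inj₁ (_ , t+1%s≡) = λ eq → 1+n≢n (trans (sym t+1%s≡) eq)
    ... | inj₂ (r+1≡s , t+1%s≡) = λ eq → <⇒≢ (≤-pred (subst (2 ≤_) (sym r+1≡s) 2≤s)) (trans (sym t+1%s≡) eq)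

    ∣-reduce-exponent : ∀ t L h → q ∣ L + p ^ t * h → q ∣ L + p ^ (t % s) * h
    ∣-reduce-exponent t L h q∣ with p^t≡p^[t%s]+e*q t
    ... | e , p^t≡ = ∣m+n∣m⇒∣n (subst (q ∣_) split q∣) (n∣m*n (e * h))
      where
      split : L + p ^ t * h ≡ (e * h) * q + (L + p ^ (t % s) * h)
      split = trans (cong (λ P → L + P * h) p^t≡) (regroup L (p ^ (t % s)) e q h)
        where
        regroup : ∀ L P e q h → L + (P + e * q) * h ≡ (e * h) * q + (L + P * h)
        regroup = solve-∀

    ∣∧0<∧<2q⇒≡q : ∀ {n} → q ∣ n → 0 < n → n < 2 * q → n ≡ q
    ∣∧0<∧<2q⇒≡q (divides zero          n≡0) 0<n _    = contradiction n≡0 (>⇒≢ 0<n)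
    ∣∧0<∧<2q⇒≡q (divides (suc zero)    n≡q) _   _    = trans n≡q (+-identityʳ q)
    ∣∧0<∧<2q⇒≡q (divides (suc (suc c)) n≡)  _   n<2q =
      contradiction (subst (2 * q ≤_) (sym n≡) (+-monoʳ-≤ q (+-monoʳ-≤ q z≤n))) (<⇒≱ n<2q)

    y+v≡q⇒digits : ∀ {y v} → y + v ≡ q → ∀ {i} → i < s → digit p i y + digit p i v ≡ suc k
    y+v≡q⇒digits {y} {v} y+v≡q {i} i<s with ⊑⇒complement (<p^⇒⊑p^∸1 {s} {v} v<p^s)
      where
      v<p^s : v < p ^ s
      v<p^s = subst (v <_) (sym p^s≡1+q) (s≤s (subst (v ≤_) y+v≡q (m≤n+m v y)))
    ... | y′ , v+y′≡q , cf = begin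
      digit p i y + digit p i v   ≡⟨ +-comm (digit p i y) (digit p i v) ⟩
      digit p i v + digit p i y   ≡⟨ cong (λ x → digit p i v + digit p i x) (sym y′≡y) ⟩
      digit p i v + digit p i y′  ≡⟨ sym (digit-+ i cf) ⟩
      digit p i (v + y′)          ≡⟨ cong (digit p i) v+y′≡q ⟩
      digit p i q                 ≡⟨ digit-p^t∸1 i i<s ⟩
      suc k                       ∎
      where
      open ≡-Reasoning
      y′≡y : y′ ≡ y
      y′≡y = +-cancelˡ-≡ v y′ y (trans v+y′≡q (sym (trans (+-comm v y) y+v≡q)))

    fold : ℕ → ℕ
    fold y = lowPart s y + highPart s y

    y≡fold+high*q : ∀ y → y ≡ fold y + highPart s y * q
    y≡fold+high*q y = trans (x≡low+p^t*high s y) (trans (cong (λ P → lowPart s y + P * highPart s y) p^s≡1+q)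
                        (regroup (lowPart s y) (highPart s y) q))
      where
      regroup : ∀ L h q → L + suc q * h ≡ (L + h) + h * q
      regroup = solve-∀

    fold<y : ∀ {y} → p ^ s ≤ y → fold y < y
    fold<y {y} p^s≤y = subst (fold y <_) (sym (y≡fold+high*q y))
      (subst (_< fold y + highPart s y * q) (+-identityʳ (fold y)) (+-monoʳ-< (fold y) (*-mono-≤ high≥1 q≥1)))
      where
      high≥1 : 1 ≤ highPart s y
      high≥1 = p^t*c≤⇒≤highPart s 1 (subst (_≤ y) (sym (*-identityʳ (p ^ s))) p^s≤y)

    ⊑-unfold : ∀ {z y} → z ⊑ fold y → ∃[ z′ ] ∃[ e ] z′ ⊑ y × z′ ≡ z + e * q
    ⊑-unfold {z} {y} z⊑ with ⊑-+-split z⊑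
    ... | x₀ , x₁ , x₀⊑ , x₁⊑ , z≡ = x₀ + p ^ s * x₁ , x₁ , z′⊑y , z′≡
      where
      z′⊑y : x₀ + p ^ s * x₁ ⊑ y
      z′⊑y = subst (x₀ + p ^ s * x₁ ⊑_) (sym (x≡low+p^t*high s y)) (⊑-block {s} x₀⊑ x₁⊑ (lowPart<p^ s y))
      z′≡ : x₀ + p ^ s * x₁ ≡ z + x₁ * q
      z′≡ = trans (cong (λ P → x₀ + P * x₁) p^s≡1+q) (trans (regroup x₀ x₁ q) (cong (_+ x₁ * q) (sym z≡)))
        where
        regroup : ∀ a b q → a + suc q * b ≡ (a + b) + b * q
        regroup = solve-∀

    p^r*α<p^s : ∀ {r α} → r < s → α < p → p ^ r * α < p ^ s
    p^r*α<p^s {r} r<s α<p =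
      <-≤-trans (*-monoʳ-< (p ^ r) {{m^n≢0 p r}} α<p) (subst (_≤ p ^ s) (*-comm p (p ^ r)) (^-monoʳ-≤ p r<s))

    p^r*β<q : ∀ {r β} → r < s → suc β < p → p ^ r * β < q
    p^r*β<q {r} {β} r<s β+1<p = ≤-pred (begin
      suc (suc (p ^ r * β))      ≤⟨ s≤s (+-monoˡ-≤ (p ^ r * β) (m^n>0 p r)) ⟩
      suc (p ^ r + p ^ r * β)    ≡⟨ cong suc (sym (*-suc (p ^ r) β)) ⟩
      suc (p ^ r * suc β)        ≤⟨ s≤s (*-monoʳ-≤ (p ^ r) (≤-pred β+1<p)) ⟩
      suc (p ^ r * suc k)        ≤⟨ +-monoˡ-≤ (p ^ r * suc k) (m^n>0 p r) ⟩
      p ^ r + p ^ r * suc k      ≡⟨ sym (*-suc (p ^ r) (suc k)) ⟩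
      p ^ r * p                  ≡⟨ *-comm (p ^ r) p ⟩
      p ^ suc r                  ≤⟨ ^-monoʳ-≤ p r<s ⟩
      p ^ s                      ≡⟨ p^s≡1+q ⟩
      suc q                      ∎)
      where open ≤-Reasoning

    p^r<q : ∀ {r} → 2 ≤ s → r < s → p ^ r * 1 < q
    p^r<q {r} 2≤s r<s = ≤-pred (subst₂ _≤_ (cong (2 +_) (sym (*-identityʳ (p ^ r))))
                                           (trans (cong (p ^_) (suc-pred s)) p^s≡1+q)
                          (2+p^r≤p^[1+s] (<⇒≤pred r<s) (pred-mono-≤ 2≤s)))

    record DivisibleSubmask (y T : ℕ) : Set where
      constructor divisibleSubmask
      field
        z   : ℕ
        z⊑y : z ⊑ y
        q∣z : q ∣ z
        0<z : 0 < z
        z<T : z < T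

    module _ {v w : ℕ} (0<v : 0 < v) (v<q : v < q) (w<p^s : w < p ^ s) (w#v : CarryFree w v) where

      -- Below p ^ s, y + v = q = (p−1 … p−1) in base p makes the digits of y complementary to those
      -- of v, so w fits in y; larger y are folded, which preserves the residue mod q.
      submask≡w[mod-q] : ∀ y → q ∣ y + v → ∃[ z ] ∃[ c ] z ⊑ y × z ≡ w + c * q
      submask≡w[mod-q] y = go y (<-wellFounded y)
        where
        go : ∀ y → Acc _<_ y → q ∣ y + v → ∃[ z ] ∃[ c ] z ⊑ y × z ≡ w + c * q
        go y (acc rs) q∣y+v with y <? p ^ s
        ... | yes y<p^s = w , 0 , w⊑y , sym (+-identityʳ w)
          where
          y+v≡q : y + v ≡ q
          y+v≡q = ∣∧0<∧<2q⇒≡q q∣y+v (≤-trans 0<v (m≤n+m v y))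
                    (+-mono-≤-< (≤-pred (subst (y <_) p^s≡1+q y<p^s)) (subst (v <_) (sym (+-identityʳ q)) v<q))
          w⊑y : w ⊑ y
          w⊑y i with i <? s
          ... | yes i<s = +-cancelʳ-≤ (digit p i v) (digit p i w) (digit p i y)
                            (subst (digit p i w + digit p i v ≤_) (sym (y+v≡q⇒digits y+v≡q i<s)) (≤-pred (w#v i)))
          ... | no i≮s  = subst (_≤ digit p i y) (sym (<p^⇒digit≡0 i w<p^s (≮⇒≥ i≮s))) z≤n
        ... | no y≮p^s with go (fold y) (rs (fold<y (≮⇒≥ y≮p^s))) q∣fold+v
          where
          q∣fold+v : q ∣ fold y + v
          q∣fold+v = ∣m+n∣m⇒∣n (subst (q ∣_) (trans (cong (_+ v) (y≡fold+high*q y)) (regroup (fold y) _ v)) q∣y+v)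
                       (n∣m*n (highPart s y))
            where
            regroup : ∀ a b c → a + b + c ≡ b + (a + c)
            regroup = solve-∀
        ... | z , c , z⊑fold , z≡ with ⊑-unfold z⊑fold
        ... | z′ , e , z′⊑y , z′≡ = z′ , c + e , z′⊑y , trans z′≡ (trans (cong (_+ e * q) z≡) (regroup w c e q))
          where
          regroup : ∀ a b c n → a + b * n + c * n ≡ a + (b + c) * n
          regroup = solve-∀

      divisible-submask : ∀ t {u y} → u < p ^ t → y < p ^ t → CarryFree u y → 0 < w →
                          q ∣ u + w → q ∣ y + v → DivisibleSubmask (u + y) (p ^ t)
      divisible-submask t {u} {y} u< y< u#y 0<w q∣u+w q∣y+v with submask≡w[mod-q] y q∣y+v
      ... | z , c , z⊑y , z≡ = divisibleSubmask (u + z) (+-mono-⊑ ⊑-refl z⊑y u#y) q∣u+z 0<u+z u+z<p^t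
        where
        q∣u+z : q ∣ u + z
        q∣u+z = subst (q ∣_) (trans (+-assoc u w (c * q)) (cong (u +_) (sym z≡))) (∣m∣n⇒∣m+n q∣u+w (n∣m*n c))
        0<u+z : 0 < u + z
        0<u+z = ≤-trans 0<w (≤-trans (subst (w ≤_) (sym z≡) (m≤m+n w (c * q))) (m≤n+m z u))
        u+z<p^t : u + z < p ^ t
        u+z<p^t = ≤-<-trans (+-monoʳ-≤ u (⊑⇒≤ z⊑y)) (CarryFree⇒+<p^ {t} u#y u< y<)

    DivisibleSubmask-⊑ : ∀ {y y′ T} → y ⊑ y′ → DivisibleSubmask y T → DivisibleSubmask y′ T
    DivisibleSubmask-⊑ y⊑y′ (divisibleSubmask z z⊑y q∣z 0<z z<T) = divisibleSubmask z (⊑-trans z⊑y y⊑y′) q∣z 0<z z<T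

    q∣low+p^[t%s]*high : ∀ t {x} → q ∣ x → q ∣ lowPart t x + p ^ (t % s) * highPart t x
    q∣low+p^[t%s]*high t {x} q∣x =
      ∣-reduce-exponent t (lowPart t x) (highPart t x) (subst (q ∣_) (x≡low+p^t*high t x) q∣x)

    -- With a = a′ + α p^t and b = b′ + β p^t, the submask is a′ + z for some z ⊑ b′ congruent to
    -- α p^(t % s) modulo q.
    divisible-submask-same-length : ∀ t {a b} → p ^ t ≤ a → a < p ^ suc t → p ^ t ≤ b → b < p ^ suc t →
                                    q ∣ a → q ∣ b → CarryFree a b → DivisibleSubmask (a + b) (p ^ t)
    divisible-submask-same-length t {a} {b} p^t≤a a<p^t+1 p^t≤b b<p^t+1 q∣a q∣b a#b
      with highPart-bounds t p^t≤a a<p^t+1 | highPart-bounds t p^t≤b b<p^t+1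
    ... | α≥1 , α<p | β≥1 , β<p =
      DivisibleSubmask-⊑ (+-mono-⊑ (lowPart⊑ t a) (lowPart⊑ t b) a#b)
        (divisible-submask (*-mono-≤ (m^n>0 p r) β≥1) (p^r*β<q r<s β+1<p) (p^r*α<p^s r<s α<p)
           (CarryFree-p^* r r α<p β<p (λ _ → α+β<p)) t (lowPart<p^ t a) (lowPart<p^ t b)
           (CarryFree-⊑ (lowPart⊑ t a) (lowPart⊑ t b) a#b) (*-mono-≤ (m^n>0 p r) α≥1)
           (q∣low+p^[t%s]*high t q∣a) (q∣low+p^[t%s]*high t q∣b))
      where
      r = t % s
      r<s = m%n<n t s
      α+β<p : highPart t a + highPart t b < p
      α+β<p = subst (_< p) (cong₂ _+_ (trans (digit≡highPart%p t a) (m<n⇒m%n≡m α<p))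
                                       (trans (digit≡highPart%p t b) (m<n⇒m%n≡m β<p))) (a#b t)
      β+1<p : suc (highPart t b) < p
      β+1<p = ≤-<-trans (+-monoˡ-≤ (highPart t b) α≥1) α+β<p

    -- Here a = a′ + p^t and b = b′ + p^(t+1); the submask is b′ + z for some z ⊑ a′, which needs
    -- t % s ≢ suc t % s.
    divisible-submask-shifted : 2 ≤ s → ∀ t {a b} → highPart t a ≡ 1 → highPart t b ≡ p →
                                q ∣ a → q ∣ b → CarryFree a b → DivisibleSubmask (a + b) (p ^ t)
    divisible-submask-shifted 2≤s t {a} {b} α≡1 β≡p q∣a q∣b a#b =
      DivisibleSubmask-⊑ (subst (lowPart t b + lowPart t a ⊑_) (+-comm b a)
                                (+-mono-⊑ (lowPart⊑ t b) (lowPart⊑ t a) b#a))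
        (divisible-submask (*-mono-≤ (m^n>0 p r) (s≤s z≤n)) (p^r<q 2≤s (m%n<n t s)) (p^r*α<p^s (m%n<n (suc t) s) 1<p)
           (CarryFree-p^* r′ r 1<p 1<p (λ r′≡r → contradiction r′≡r (suc[t]%s≢t%s 2≤s t)))
           t (lowPart<p^ t b) (lowPart<p^ t a)
           (CarryFree-⊑ (lowPart⊑ t b) (lowPart⊑ t a) b#a) (*-mono-≤ (m^n>0 p r′) (s≤s z≤n)) q∣lb+w q∣la+v)
      where
      r  = t % s
      r′ = suc t % s
      1<p : 1 < p
      1<p = s≤s (s≤s z≤n)
      b#a = CarryFree-sym a#b
      q∣la+v : q ∣ lowPart t a + p ^ r * 1
      q∣la+v = subst (λ h → q ∣ lowPart t a + p ^ r * h) α≡1 (q∣low+p^[t%s]*high t q∣a)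
      q∣lb+w : q ∣ lowPart t b + p ^ r′ * 1
      q∣lb+w = ∣-reduce-exponent (suc t) (lowPart t b) 1 (subst (q ∣_) b≡ q∣b)
        where
        open ≡-Reasoning
        b≡ : b ≡ lowPart t b + p ^ suc t * 1
        b≡ = begin
          b                                   ≡⟨ x≡low+p^t*high t b ⟩
          lowPart t b + p ^ t * highPart t b  ≡⟨ cong (λ h → lowPart t b + p ^ t * h) β≡p ⟩
          lowPart t b + p ^ t * p             ≡⟨ cong (lowPart t b +_) (trans (*-comm (p ^ t) p) (sym (*-identityʳ (p ^ suc t)))) ⟩
          lowPart t b + p ^ suc t * 1         ∎

sumF-cong : ∀ m {f g : Fin m → ℕ} → (∀ i → f i ≡ g i) → sumF m f ≡ sumF m g
sumF-cong zero    f≗g = refl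
sumF-cong (suc m) f≗g = cong₂ _+_ (f≗g F.zero) (sumF-cong m (λ i → f≗g (F.suc i)))

sumF-agree₁ : ∀ m (f g : Fin m → ℕ) j → (∀ i → i ≢ j → f i ≡ g i) → sumF m f + g j ≡ sumF m g + f j
sumF-agree₁ (suc m) f g F.zero    f≗g = begin
  f F.zero + sumF m (λ i → f (F.suc i)) + g F.zero  ≡⟨ cong (λ S → f F.zero + S + g F.zero)
                                                         (sumF-cong m (λ i → f≗g (F.suc i) λ ())) ⟩
  f F.zero + sumF m (λ i → g (F.suc i)) + g F.zero  ≡⟨ swap (f F.zero) _ (g F.zero) ⟩
  g F.zero + sumF m (λ i → g (F.suc i)) + f F.zero  ∎
  where
  open ≡-Reasoning
  swap : ∀ a b c → a + b + c ≡ c + b + a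
  swap = solve-∀
sumF-agree₁ (suc m) f g (F.suc j) f≗g = begin
  f F.zero + sumF m (λ i → f (F.suc i)) + g (F.suc j)    ≡⟨ +-assoc (f F.zero) _ _ ⟩
  f F.zero + (sumF m (λ i → f (F.suc i)) + g (F.suc j))  ≡⟨ cong₂ _+_ (f≗g F.zero λ ())
                                                              (sumF-agree₁ m _ _ j λ i i≢j → f≗g (F.suc i) (i≢j ∘ Fin.suc-injective)) ⟩
  g F.zero + (sumF m (λ i → g (F.suc i)) + f (F.suc j))  ≡⟨ +-assoc (g F.zero) _ _ ⟨
  g F.zero + sumF m (λ i → g (F.suc i)) + f (F.suc j)    ∎
  where open ≡-Reasoning

sumF-agree₂ : ∀ m (f g : Fin m → ℕ) {j l} → j ≢ l → (∀ i → i ≢ j → i ≢ l → f i ≡ g i) →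
              sumF m f + (g j + g l) ≡ sumF m g + (f j + f l)
sumF-agree₂ m f g {j} {l} j≢l f≗g = begin
  sumF m f + (g j + g l)   ≡⟨ +-assoc (sumF m f) (g j) (g l) ⟨
  sumF m f + g j + g l     ≡⟨ cong (_+ g l) (trans (cong (sumF m f +_) (sym h-j)) (sumF-agree₁ m f h j f≗h)) ⟩
  sumF m h + f j + g l     ≡⟨ swap (sumF m h) (f j) (g l) ⟩
  sumF m h + g l + f j     ≡⟨ cong (_+ f j) (trans (sumF-agree₁ m h g l h≗g) (cong (sumF m g +_) h-l)) ⟩
  sumF m g + f l + f j     ≡⟨ swap′ (sumF m g) (f l) (f j) ⟩
  sumF m g + (f j + f l)   ∎
  where
  open ≡-Reasoning
  h : Fin m → ℕ
  h = updateAt f j (const (g j))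
  h-j : h j ≡ g j
  h-j = updateAt-updates j f
  h-l : h l ≡ f l
  h-l = updateAt-minimal l j f (j≢l ∘ sym)
  f≗h : ∀ i → i ≢ j → f i ≡ h i
  f≗h i i≢j = sym (updateAt-minimal i j f i≢j)
  h≗g : ∀ i → i ≢ l → h i ≡ g i
  h≗g i i≢l with i F.≟ j
  ... | yes refl = h-j
  ... | no i≢j   = trans (sym (f≗h i i≢j)) (f≗g i i≢j i≢l)
  swap : ∀ a b c → a + b + c ≡ a + c + b
  swap = solve-∀
  swap′ : ∀ a b c → a + b + c ≡ a + (c + b)
  swap′ = solve-∀

sumF-single≤ : ∀ m (f : Fin m → ℕ) j → f j ≤ sumF m f
sumF-single≤ (suc m) f F.zero    = m≤m+n _ _
sumF-single≤ (suc m) f (F.suc j) = ≤-trans (sumF-single≤ m (λ i → f (F.suc i)) j) (m≤n+m _ _)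

sumF-pair≤ : ∀ m (f : Fin m → ℕ) {j l} → j ≢ l → f j + f l ≤ sumF m f
sumF-pair≤ (suc m) f {F.zero}  {F.zero}  j≢l = contradiction refl j≢l
sumF-pair≤ (suc m) f {F.zero}  {F.suc l} _   = +-monoʳ-≤ (f F.zero) (sumF-single≤ m (λ i → f (F.suc i)) l)
sumF-pair≤ (suc m) f {F.suc j} {F.zero}  _   =
  subst (_≤ sumF (suc m) f) (+-comm (f F.zero) (f (F.suc j))) (+-monoʳ-≤ (f F.zero) (sumF-single≤ m (λ i → f (F.suc i)) j))
sumF-pair≤ (suc m) f {F.suc j} {F.suc l} j≢l =
  ≤-trans (sumF-pair≤ m (λ i → f (F.suc i)) (j≢l ∘ cong F.suc)) (m≤n+m _ (f F.zero))

∣-sumF : ∀ {d} m {f : Fin m → ℕ} → (∀ i → d ∣ f i) → d ∣ sumF m f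
∣-sumF zero    d∣f = divides 0 refl
∣-sumF (suc m) d∣f = ∣m∣n⇒∣m+n (d∣f F.zero) (∣-sumF m (λ i → d∣f (F.suc i)))

∣-remaining-summand : ∀ {d} m {f : Fin m → ℕ} j → d ∣ sumF m f → (∀ i → i ≢ j → d ∣ f i) → d ∣ f j
∣-remaining-summand {d} (suc m) {f} F.zero    d∣Σ d∣others =
  ∣m+n∣m⇒∣n (subst (d ∣_) (+-comm (f F.zero) _) d∣Σ) (∣-sumF m (λ i → d∣others (F.suc i) λ ()))
∣-remaining-summand (suc m) {f} (F.suc j) d∣Σ d∣others =
  ∣-remaining-summand m j (∣m+n∣m⇒∣n d∣Σ (d∣others F.zero λ ()))
    (λ i i≢j → d∣others (F.suc i) (i≢j ∘ Fin.suc-injective))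

no-improvement : ∀ {p s m N} {X Y : Fin m → ℕ} l → Optimal p s m N X ⊎ Greedy p s m N X → InV p s m N Y →
                 wt m X < wt m Y → X l < Y l → (∀ i → toℕ l < toℕ i → Y i ≡ X i) → ⊥
no-improvement l (inj₁ (_ , optimal)) Y∈V wt< _ _ = <⇒≱ wt< (optimal _ Y∈V)
no-improvement {X = X} {Y} l (inj₂ (_ , greedy)) Y∈V _ Xl<Yl Y≗X-above with greedy _ Y∈V
... | inj₁ Y≗X = <⇒≢ Xl<Yl (sym (Y≗X l))
... | inj₂ (i , Y≗X-above-i , Yi<Xi) with <-cmp (toℕ i) (toℕ l)
...   | tri< i<l _ _ = <⇒≢ Xl<Yl (sym (Y≗X-above-i l i<l))
...   | tri≈ _ i≡l _ = <-asym Xl<Yl (subst (λ j → Y j < X j) (toℕ-injective i≡l) Yi<Xi)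
...   | tri> _ _ l<i = <⇒≢ Yi<Xi (Y≗X-above i l<i)

module Exchange {m} (X : Fin m → ℕ) {j l : Fin m} (j<l : toℕ j < toℕ l)
                {z w} (z+w≡ : z + w ≡ X j + X l) (z<Xj : z < X j) where

  Y : Fin m → ℕ
  Y = updateAt (updateAt X j (const z)) l (const w)

  j≢l : j ≢ l
  j≢l = Fin.<⇒≢ j<l

  Y-j : Y j ≡ z
  Y-j = trans (updateAt-minimal j l _ j≢l) (updateAt-updates j X)

  Y-l : Y l ≡ w
  Y-l = updateAt-updates l _

  X≗Y-elsewhere : ∀ i → i ≢ j → i ≢ l → X i ≡ Y i
  X≗Y-elsewhere i i≢j i≢l = sym (trans (updateAt-minimal i l _ i≢l) (updateAt-minimal i j X i≢j))

  Xl<Yl : X l < Y l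
  Xl<Yl = subst (X l <_) (sym Y-l) (+-cancelˡ-< (X j) (X l) w (subst (_< X j + w) z+w≡ (+-monoˡ-< w z<Xj)))

  Y≗X-above : ∀ i → toℕ l < toℕ i → Y i ≡ X i
  Y≗X-above i l<i = sym (X≗Y-elsewhere i (≢-sym (Fin.<⇒≢ (<-trans j<l l<i))) (≢-sym (Fin.<⇒≢ l<i)))

  sumF-exchange : (f : ℕ → ℕ) → f z + f w ≡ f (X j) + f (X l) → sumF m (λ i → f (Y i)) ≡ sumF m (λ i → f (X i))
  sumF-exchange f f-preserved = +-cancelʳ-≡ (f (X j) + f (X l)) _ _ (begin
    sumF m (λ i → f (Y i)) + (f (X j) + f (X l))   ≡⟨ sumF-agree₂ m _ _ j≢l
                                                        (λ i i≢j i≢l → cong f (sym (X≗Y-elsewhere i i≢j i≢l))) ⟩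
    sumF m (λ i → f (X i)) + (f (Y j) + f (Y l))   ≡⟨ cong (λ v → sumF m (λ i → f (X i)) + v)
                                                       (trans (cong₂ (λ a b → f a + f b) Y-j Y-l) f-preserved) ⟩
    sumF m (λ i → f (X i)) + (f (X j) + f (X l))   ∎)
    where open ≡-Reasoning

  wtX<wtY : wt m X < wt m Y
  wtX<wtY = +-cancelʳ-< (cⱼ * X j + cₗ * X l) (wt m X) (wt m Y) (begin-strict
    wt m X + (cⱼ * X j + cₗ * X l)    <⟨ +-monoʳ-< (wt m X) gain ⟩
    wt m X + (cⱼ * Y j + cₗ * Y l)    ≡⟨ sumF-agree₂ m _ _ j≢l
                                           (λ i i≢j i≢l → cong (suc (toℕ i) *_) (X≗Y-elsewhere i i≢j i≢l)) ⟩
    wt m Y + (cⱼ * X j + cₗ * X l)    ∎)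
    where
    open ≤-Reasoning
    cⱼ = suc (toℕ j)
    cₗ = suc (toℕ l)
    D = X j ∸ z
    0<D : 0 < D
    0<D = m<n⇒0<n∸m z<Xj
    Xj≡ : X j ≡ z + D
    Xj≡ = sym (m+[n∸m]≡n (<⇒≤ z<Xj))
    w≡ : w ≡ X l + D
    w≡ = +-cancelˡ-≡ z w (X l + D) (trans z+w≡ (trans (cong (_+ X l) Xj≡) (regroup z D (X l))))
      where
      regroup : ∀ a b c → a + b + c ≡ a + (c + b)
      regroup = solve-∀
    gain : cⱼ * X j + cₗ * X l < cⱼ * Y j + cₗ * Y l
    gain = begin-strict
      cⱼ * X j + cₗ * X l          ≡⟨ cong (λ a → cⱼ * a + cₗ * X l) Xj≡ ⟩
      cⱼ * (z + D) + cₗ * X l      ≡⟨ regroup cⱼ z D cₗ (X l) ⟩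
      (cⱼ * z + cₗ * X l) + cⱼ * D <⟨ +-monoʳ-< (cⱼ * z + cₗ * X l) (*-monoˡ-< D {{>-nonZero 0<D}} (s≤s j<l)) ⟩
      (cⱼ * z + cₗ * X l) + cₗ * D ≡⟨ regroup′ cⱼ z D cₗ (X l) ⟩
      cⱼ * z + cₗ * (X l + D)      ≡⟨ cong₂ (λ a b → cⱼ * a + cₗ * b) (sym Y-j) (trans (sym w≡) (sym Y-l)) ⟩
      cⱼ * Y j + cₗ * Y l          ∎
      where
      regroup : ∀ a z d b x → a * (z + d) + b * x ≡ (a * z + b * x) + a * d
      regroup = solve-∀
      regroup′ : ∀ a z d b x → (a * z + b * x) + b * d ≡ a * z + b * (x + d)
      regroup′ = solve-∀

module Extremal (k s : ℕ) .{{_ : NonZero s}} {m N} {X : Fin m → ℕ}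
                (X∈V : InV (2 + k) s m N X)
                (extremal : Optimal (2 + k) s m N X ⊎ Greedy (2 + k) s m N X)
                (q∣N : (2 + k) ^ s ∸ 1 ∣ N) where

  open Digits k
  open Modulus s

  X>0 : ∀ i → 0 < X i
  X>0 = proj₁ X∈V

  private
    ΣX≡N : sumF m X ≡ N
    ΣX≡N = proj₁ (proj₂ X∈V)
    X-noCarry : NoCarry p m X
    X-noCarry = proj₁ (proj₂ (proj₂ X∈V))
    q∣X-not-last : ∀ i → suc (toℕ i) < m → q ∣ X i
    q∣X-not-last = proj₂ (proj₂ (proj₂ X∈V))

  X-CarryFree : ∀ {j l} → j ≢ l → CarryFree (X j) (X l)
  X-CarryFree j≢l d = ≤-<-trans (sumF-pair≤ m (λ i → digit p d (X i)) j≢l) (X-noCarry d)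

  q∣X : ∀ i → q ∣ X i
  q∣X i with suc (toℕ i) <? m
  ... | yes i-not-last = q∣X-not-last i i-not-last
  ... | no i-last = ∣-remaining-summand m i (subst (q ∣_) (sym ΣX≡N) q∣N)
                      λ j j≢i → q∣X-not-last j (≤-trans (s≤s (j<i j j≢i)) (toℕ<n i))
    where
    j<i : ∀ j → j ≢ i → toℕ j < toℕ i
    j<i j j≢i = ≤∧≢⇒< (≤-pred (≤-trans (toℕ<n j) (≮⇒≥ i-last))) (j≢i ∘ toℕ-injective)

  -- Replacing (X j, X l) by (z, X j + X l ∸ z) gives an element of V that is heavier and
  -- reverse-lexicographically larger.
  no-divisible-submask : ∀ {j l T} → toℕ j < toℕ l → T ≤ X j → DivisibleSubmask (X j + X l) T → ⊥
  no-divisible-submask {j} {l} j<l T≤Xj (divisibleSubmask z z⊑ q∣z 0<z z<T) with ⊑⇒complement z⊑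
  ... | w , z+w≡ , z#w = no-improvement {s = s} l extremal Y∈V wtX<wtY Xl<Yl Y≗X-above
    where
    open Exchange X j<l z+w≡ (<-≤-trans z<T T≤Xj)
    Y>0 : ∀ i → 0 < Y i
    Y>0 i with i F.≟ j | i F.≟ l
    ... | yes refl | _        = subst (0 <_) (sym Y-j) 0<z
    ... | no _     | yes refl = ≤-<-trans z≤n Xl<Yl
    ... | no i≢j   | no i≢l   = subst (0 <_) (X≗Y-elsewhere i i≢j i≢l) (X>0 i)
    ΣY≡N : sumF m Y ≡ N
    ΣY≡N = trans (sumF-exchange (λ x → x) z+w≡) ΣX≡N
    Y-noCarry : NoCarry p m Y
    Y-noCarry d = subst (_< p) (sym (sumF-exchange (digit p d) digits-preserved)) (X-noCarry d)
      where
      digits-preserved : digit p d z + digit p d w ≡ digit p d (X j) + digit p d (X l)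
      digits-preserved = trans (sym (digit-+ d z#w)) (trans (cong (digit p d) z+w≡) (digit-+ d (X-CarryFree j≢l)))
    q∣Y : ∀ i → suc (toℕ i) < m → q ∣ Y i
    q∣Y i _ with i F.≟ j | i F.≟ l
    ... | yes refl | _        = subst (q ∣_) (sym Y-j) q∣z
    ... | no _     | yes refl =
      subst (q ∣_) (sym Y-l) (∣m+n∣m⇒∣n (subst (q ∣_) (sym z+w≡) (∣m∣n⇒∣m+n (q∣X j) (q∣X l))) q∣z)
    ... | no i≢j   | no i≢l   = subst (q ∣_) (X≗Y-elsewhere i i≢j i≢l) (q∣X i)
    Y∈V : InV p s m N Y
    Y∈V = Y>0 , ΣY≡N , Y-noCarry , q∣Y

  X-mono : ∀ {j l} → toℕ j < toℕ l → X j ≤ X l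
  X-mono {j} {l} j<l with X l <? X j
  ... | no Xl≮Xj = ≮⇒≥ Xl≮Xj
  ... | yes Xl<Xj = ⊥-elim (no-divisible-submask j<l Xl<Xj
                      (divisibleSubmask (X l) (⊑-+ʳ (X-CarryFree (Fin.<⇒≢ j<l))) (q∣X l) (X>0 l) ≤-refl))

  ⌊log⌋-increasing : ∀ {j l} → toℕ j < toℕ l → ⌊log⌋ (X j) < ⌊log⌋ (X l)
  ⌊log⌋-increasing {j} {l} j<l = p^a≤y<p^suc[c]⇒a≤c p^[t+1]≤Xl (<p^suc⌊log⌋ (X>0 l))
    where
    t = ⌊log⌋ (X j)
    p^[t+1]≤Xl : p ^ suc t ≤ X l
    p^[t+1]≤Xl with X l <? p ^ suc t
    ... | no Xl≮ = ≮⇒≥ Xl≮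
    ... | yes Xl< = ⊥-elim (no-divisible-submask j<l (p^⌊log⌋≤ (X>0 j))
                      (divisible-submask-same-length t (p^⌊log⌋≤ (X>0 j)) (<p^suc⌊log⌋ (X>0 j))
                        (≤-trans (p^⌊log⌋≤ (X>0 j)) (X-mono j<l)) Xl< (q∣X j) (q∣X l)
                        (X-CarryFree (Fin.<⇒≢ j<l))))

-- For p = 2 the growth of the number of digits is too weak (Σ_{i≥1} i 2^(−i) = 2), and the
-- exchange argument is pushed further to give X l ≥ 2 X j.
module BinaryExtremal (s : ℕ) .{{_ : NonZero s}} {m N} {X : Fin m → ℕ}
                      (X∈V : InV 2 s m N X)
                      (extremal : Optimal 2 s m N X ⊎ Greedy 2 s m N X)
                      (q∣N : 2 ^ s ∸ 1 ∣ N) where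

  open Digits 0
  open Modulus s
  open Extremal 0 s X∈V extremal q∣N

  private
    1≤n<2⇒n≡1 : ∀ {n} → 1 ≤ n → n < 2 → n ≡ 1
    1≤n<2⇒n≡1 {1} _ _ = refl
    1≤n<2⇒n≡1 {suc (suc _)} _ (s≤s (s≤s ()))

    2≤n<4∧even⇒n≡2 : ∀ {n} → 2 ≤ n → n < 4 → 1 + n % 2 < 2 → n ≡ 2
    2≤n<4∧even⇒n≡2 {1} (s≤s ()) _ _
    2≤n<4∧even⇒n≡2 {2} _ _ _ = refl
    2≤n<4∧even⇒n≡2 {3} _ _ (s≤s (s≤s ()))
    2≤n<4∧even⇒n≡2 {suc (suc (suc (suc _)))} _ (s≤s (s≤s (s≤s (s≤s ())))) _

  module _ {j l : Fin m} (j<l : toℕ j < toℕ l) where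

    private
      t = ⌊log⌋ (X j)
      j≢l = Fin.<⇒≢ j<l
      α≡1 : highPart t (X j) ≡ 1
      α≡1 = uncurry 1≤n<2⇒n≡1 (highPart-bounds t (p^⌊log⌋≤ (X>0 j)) (<p^suc⌊log⌋ (X>0 j)))

    2^[t+1]≤Xl : 2 ^ suc (⌊log⌋ (X j)) ≤ X l
    2^[t+1]≤Xl = ≤-trans (^-monoʳ-≤ 2 (⌊log⌋-increasing j<l)) (p^⌊log⌋≤ (X>0 l))

    Xj≡2^t : s ≡ 1 → X j ≡ 2 ^ ⌊log⌋ (X j)
    Xj≡2^t s≡1 with lowPart t (X j) in low≡
    ... | zero  = trans (x≡low+p^t*high t (X j))
                    (trans (cong₂ (λ L h → L + p ^ t * h) low≡ α≡1) (*-identityʳ (p ^ t)))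
    ... | suc _ = ⊥-elim (no-divisible-submask j<l (p^⌊log⌋≤ (X>0 j))
                    (divisibleSubmask (lowPart t (X j)) (⊑-trans (lowPart⊑ t (X j)) (⊑-+ˡ (X-CarryFree j≢l)))
                       (subst (λ s′ → 2 ^ s′ ∸ 1 ∣ lowPart t (X j)) (sym s≡1) (1∣ _))
                       (subst (0 <_) (sym low≡) (s≤s z≤n)) (lowPart<p^ t (X j))))

    2^[t+2]≤Xl : 2 ≤ s → 2 ^ suc (suc (⌊log⌋ (X j))) ≤ X l
    2^[t+2]≤Xl 2≤s with X l <? 2 ^ suc (suc t)
    ... | no Xl≮ = ≮⇒≥ Xl≮
    ... | yes Xl< = ⊥-elim (no-divisible-submask j<l (p^⌊log⌋≤ (X>0 j))
                      (divisible-submask-shifted 2≤s t α≡1 β≡2 (q∣X j) (q∣X l) (X-CarryFree j≢l)))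
      where
      β≡2 : highPart t (X l) ≡ 2
      β≡2 = 2≤n<4∧even⇒n≡2 (p^t*c≤⇒≤highPart t 2 (subst (_≤ X l) (*-comm 2 (2 ^ t)) 2^[t+1]≤Xl))
              (<p^t*c⇒highPart< t 4 (subst (X l <_) (2^[t+2]≡ t) Xl<))
              (subst (_< 2) (cong₂ _+_ (trans (digit≡highPart%p t (X j)) (cong (_% 2) α≡1)) (digit≡highPart%p t (X l)))
                 (X-CarryFree j≢l t))
        where
        2^[t+2]≡ : ∀ t → 2 ^ suc (suc t) ≡ 2 ^ t * 4
        2^[t+2]≡ t = trans (sym (*-assoc 2 2 (2 ^ t))) (*-comm 4 (2 ^ t))

  doubling : ∀ {j l} → toℕ j < toℕ l → 2 * X j ≤ X l
  doubling {j} {l} j<l with s ≟ 1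
  ... | yes s≡1 = subst (λ x → 2 * x ≤ X l) (sym (Xj≡2^t j<l s≡1)) (2^[t+1]≤Xl j<l)
  ... | no s≢1  = <⇒≤ (<-≤-trans (*-monoʳ-< 2 (<p^suc⌊log⌋ (X>0 j))) (2^[t+2]≤Xl j<l 2≤s))
    where
    2≤s : 2 ≤ s
    2≤s = ≤∧≢⇒< (>-nonZero⁻¹ s) (s≢1 ∘ sym)

∑< : (ℕ → ℕ) → ℕ → ℕ
∑< x zero    = 0
∑< x (suc n) = ∑< x n + x n

∑<-cons : ∀ x n → ∑< x (suc n) ≡ x 0 + ∑< (λ i → x (suc i)) n
∑<-cons x zero    = +-comm 0 (x 0)
∑<-cons x (suc n) = trans (cong (_+ x (suc n)) (∑<-cons x n)) (+-assoc (x 0) _ (x (suc n)))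

sumF≡∑< : ∀ m (x : ℕ → ℕ) → sumF m (λ i → x (toℕ i)) ≡ ∑< x m
sumF≡∑< zero    x = refl
sumF≡∑< (suc m) x = trans (cong (x 0 +_) (sumF≡∑< m (λ i → x (suc i)))) (sym (∑<-cons x m))

-- ∑< (∑< x) n = Σ_{i<n} (n − 1 − i) x i.
weighted+∑∑≡ : ∀ x n → ∑< (λ i → suc i * x i) n + ∑< (∑< x) n ≡ n * ∑< x n
weighted+∑∑≡ x zero    = refl
weighted+∑∑≡ x (suc n) = begin
  W + suc n * x n + (S + ∑< x n)      ≡⟨ regroup W S (∑< x n) (x n) n ⟩
  (W + S) + ∑< x n + suc n * x n      ≡⟨ cong (λ v → v + ∑< x n + suc n * x n) (weighted+∑∑≡ x n) ⟩
  n * ∑< x n + ∑< x n + suc n * x n   ≡⟨ regroup′ n (∑< x n) (x n) ⟩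
  suc n * (∑< x n + x n)              ∎
  where
  open ≡-Reasoning
  W = ∑< (λ i → suc i * x i) n
  S = ∑< (∑< x) n
  regroup : ∀ a b c d n → a + suc n * d + (b + c) ≡ (a + b) + c + suc n * d
  regroup = solve-∀
  regroup′ : ∀ n P y → n * P + P + suc n * y ≡ suc n * (P + y)
  regroup′ = solve-∀

weighted+∑∑≡′ : ∀ x n → ∑< (λ i → suc i * x i) (suc n) + ∑< (∑< x) n ≡ n * ∑< x (suc n) + x n
weighted+∑∑≡′ x n = +-cancelʳ-≡ (∑< x n) _ _ (begin
  W + ∑< (∑< x) n + ∑< x n             ≡⟨ +-assoc W (∑< (∑< x) n) (∑< x n) ⟩
  W + ∑< (∑< x) (suc n)                ≡⟨ weighted+∑∑≡ x (suc n) ⟩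
  suc n * ∑< x (suc n)                 ≡⟨ regroup n (∑< x n) (x n) ⟩
  n * ∑< x (suc n) + x n + ∑< x n      ∎)
  where
  open ≡-Reasoning
  W = ∑< (λ i → suc i * x i) (suc n)
  regroup : ∀ n P y → suc n * (P + y) ≡ n * (P + y) + y + P
  regroup = solve-∀

weighted-sum-bounds : ∀ x n → ∑< (∑< x) n < x n →
                      n * ∑< x (suc n) < ∑< (λ i → suc i * x i) (suc n) ×
                      ∑< (λ i → suc i * x i) (suc n) ≤ suc n * ∑< x (suc n)
weighted-sum-bounds x n ∑∑<x = lower , upper
  where
  W = ∑< (λ i → suc i * x i) (suc n)
  lower : n * ∑< x (suc n) < W
  lower = +-cancelʳ-< (x n) _ W (subst (_< W + x n) (weighted+∑∑≡′ x n) (+-monoʳ-< W ∑∑<x))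
  upper : W ≤ suc n * ∑< x (suc n)
  upper = ≤-trans (m≤m+n W (∑< (∑< x) (suc n))) (≤-reflexive (weighted+∑∑≡ x (suc n)))

doubling⇒∑∑<last : ∀ (x : ℕ → ℕ) n → 0 < x 0 → (∀ i → i < n → 2 * x i ≤ x (suc i)) → ∑< (∑< x) n < x n
doubling⇒∑∑<last x n 0<x₀ doubles = proj₂ (bounds n ≤-refl)
  where
  bounds : ∀ j → j ≤ n → ∑< x j < x j × ∑< (∑< x) j < x j
  bounds zero    _   = 0<x₀ , 0<x₀
  bounds (suc j) j<n with bounds j (<⇒≤ j<n)
  ... | ∑<x , ∑∑<x = <-≤-trans (+-monoˡ-< (x j) ∑<x) 2xj≤ , <-≤-trans (+-mono-< ∑∑<x ∑<x) 2xj≤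
    where
    2xj≤ : x j + x j ≤ x (suc j)
    2xj≤ = subst (_≤ x (suc j)) (cong (x j +_) (+-identityʳ (x j))) (doubles j j<n)

-- The invariants come from Σ_{i≥0} b^(−i) ≤ 3/2 and Σ_{i≥1} i b^(−i) ≤ 3/4 for b ≥ 3.
geometric⇒∑∑<last : ∀ {b} (x B : ℕ → ℕ) n → 3 ≤ b → (∀ i → i < n → x i ≤ b * B i) → (∀ i → i < n → b * B i ≤ B (suc i)) →
                    B n ≤ x n → 0 < B n → ∑< (∑< x) n < x n
geometric⇒∑∑<last {b} x B n 3≤b x≤bB bB≤B B≤x 0<B = *-cancelˡ-< 4 (∑< (∑< x) n) (x n) (begin-strict
  4 * ∑< (∑< x) n  ≤⟨ proj₂ (bounds n ≤-refl) ⟩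
  3 * B n          ≤⟨ *-monoʳ-≤ 3 B≤x ⟩
  3 * x n          <⟨ m<m+n (3 * x n) (<-≤-trans 0<B B≤x) ⟩
  3 * x n + x n    ≡⟨ three+one (x n) ⟩
  4 * x n          ∎)
  where
  open ≤-Reasoning
  three+one : ∀ a → 3 * a + a ≡ 4 * a
  three+one = solve-∀
  bounds : ∀ j → j ≤ n → 2 * ∑< x j ≤ 3 * B j × 4 * ∑< (∑< x) j ≤ 3 * B j
  bounds zero    _   = z≤n , z≤n
  bounds (suc j) j<n with bounds j (<⇒≤ j<n)
  ... | ∑<x , ∑∑<x = step₁ , step₂
    where
    step₁ : 2 * (∑< x j + x j) ≤ 3 * B (suc j)
    step₁ = begin
      2 * (∑< x j + x j)         ≡⟨ *-distribˡ-+ 2 (∑< x j) (x j) ⟩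
      2 * ∑< x j + 2 * x j       ≤⟨ +-mono-≤ ∑<x (*-monoʳ-≤ 2 (x≤bB j j<n)) ⟩
      3 * B j + 2 * (b * B j)    ≤⟨ +-monoˡ-≤ (2 * (b * B j)) (*-monoˡ-≤ (B j) 3≤b) ⟩
      b * B j + 2 * (b * B j)    ≡⟨ regroup (b * B j) ⟩
      3 * (b * B j)              ≤⟨ *-monoʳ-≤ 3 (bB≤B j j<n) ⟩
      3 * B (suc j)              ∎
      where
      regroup : ∀ a → a + 2 * a ≡ 3 * a
      regroup = solve-∀
    step₂ : 4 * (∑< (∑< x) j + ∑< x j) ≤ 3 * B (suc j)
    step₂ = begin
      4 * (∑< (∑< x) j + ∑< x j)           ≡⟨ regroup (∑< (∑< x) j) (∑< x j) ⟩
      4 * ∑< (∑< x) j + 2 * (2 * ∑< x j)   ≤⟨ +-mono-≤ ∑∑<x (*-monoʳ-≤ 2 ∑<x) ⟩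
      3 * B j + 2 * (3 * B j)              ≡⟨ regroup′ (B j) ⟩
      3 * (3 * B j)                        ≤⟨ *-monoʳ-≤ 3 (*-monoˡ-≤ (B j) 3≤b) ⟩
      3 * (b * B j)                        ≤⟨ *-monoʳ-≤ 3 (bB≤B j j<n) ⟩
      3 * B (suc j)                        ∎
      where
      regroup : ∀ a c → 4 * (a + c) ≡ 4 * a + 2 * (2 * c)
      regroup = solve-∀
      regroup′ : ∀ a → 3 * a + 2 * (3 * a) ≡ 3 * (3 * a)
      regroup′ = solve-∀

extend : ∀ {m} → (Fin m → ℕ) → ℕ → ℕ
extend {zero}  X _       = 0
extend {suc m} X zero    = X F.zero
extend {suc m} X (suc i) = extend (λ j → X (F.suc j)) i

extend-toℕ : ∀ {m} (X : Fin m → ℕ) j → extend X (toℕ j) ≡ X j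
extend-toℕ {suc m} X F.zero    = refl
extend-toℕ {suc m} X (F.suc j) = extend-toℕ (λ j → X (F.suc j)) j

sumF≡∑<-extend : ∀ m (X : Fin m → ℕ) (f : ℕ → ℕ → ℕ) →
                 sumF m (λ i → f (toℕ i) (X i)) ≡ ∑< (λ i → f i (extend X i)) m
sumF≡∑<-extend m X f =
  trans (sumF-cong m (λ i → cong (f (toℕ i)) (sym (extend-toℕ X i)))) (sumF≡∑< m (λ i → f i (extend X i)))

extend-fromℕ< : ∀ {m} (X : Fin m → ℕ) {i} (i<m : i < m) → extend X i ≡ X (fromℕ< i<m)
extend-fromℕ< X i<m = trans (cong (extend X) (sym (toℕ-fromℕ< i<m))) (extend-toℕ X (fromℕ< i<m))

extend-pointwise : ∀ {m} (X : Fin m → ℕ) (P : ℕ → Set) → (∀ j → P (X j)) → ∀ {i} → i < m → P (extend X i)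
extend-pointwise X P P-X i<m = subst P (sym (extend-fromℕ< X i<m)) (P-X (fromℕ< i<m))

extend-consecutive : ∀ {m} (X : Fin m → ℕ) (R : ℕ → ℕ → Set) → (∀ {j l} → toℕ j < toℕ l → R (X j) (X l)) →
                     ∀ {i} → suc i < m → R (extend X i) (extend X (suc i))
extend-consecutive X R R-X {i} i+1<m =
  subst₂ R (sym (extend-fromℕ< X i<m)) (sym (extend-fromℕ< X i+1<m))
    (R-X (subst₂ _<_ (sym (toℕ-fromℕ< i<m)) (sym (toℕ-fromℕ< i+1<m)) ≤-refl))
  where
  i<m = <-trans (n<1+n i) i+1<m

∑∑<last : ∀ k s .{{_ : NonZero s}} n {N} {X : Fin (suc n) → ℕ} → InV (2 + k) s (suc n) N X →
          Optimal (2 + k) s (suc n) N X ⊎ Greedy (2 + k) s (suc n) N X → (2 + k) ^ s ∸ 1 ∣ N →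
          ∑< (∑< (extend X)) n < extend X n
∑∑<last zero s n {X = X} X∈V extremal q∣N =
  doubling⇒∑∑<last (extend X) n (extend-pointwise X (0 <_) X>0 z<s)
    (λ i i<n → extend-consecutive X (λ a b → 2 * a ≤ b) doubling (s<s i<n))
  where
  open Extremal 0 s X∈V extremal q∣N
  open BinaryExtremal s X∈V extremal q∣N
∑∑<last (suc k) s n {X = X} X∈V extremal q∣N =
  geometric⇒∑∑<last {p} (extend X) (λ i → p ^ ⌊log⌋ (extend X i)) n (s≤s (s≤s (s≤s z≤n)))
    (λ i i<n → extend-pointwise X (λ a → a ≤ p * p ^ ⌊log⌋ a) (λ j → <⇒≤ (<p^suc⌊log⌋ (X>0 j)))
                 (<-trans i<n (n<1+n n)))
    (λ i i<n → extend-consecutive X (λ a b → p * p ^ ⌊log⌋ a ≤ p ^ ⌊log⌋ b)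
                 (λ j<l → ^-monoʳ-≤ p (⌊log⌋-increasing j<l)) (s<s i<n))
    (extend-pointwise X (λ a → p ^ ⌊log⌋ a ≤ a) (λ j → p^⌊log⌋≤ (X>0 j)) (n<1+n n))
    (m^n>0 p (⌊log⌋ (extend X n)))
  where
  open Digits (suc k)
  open Extremal (suc k) s X∈V extremal q∣N

-- Primality of p is used only through p ≥ 2; non-emptiness of V_m(N) and 1 ≤ N follow from X ∈ V_m(N).
proposition4p6 : (p s m N : ℕ) → Prime p → 1 ≤ s → 1 ≤ m → 1 ≤ N
    → (p ^ s ∸ 1) ∣ N
    → Σ (Fin m → ℕ) (λ Y → InV p s m N Y)
    → (X : Fin m → ℕ)
    → Optimal p s m N X ⊎ Greedy p s m N X
    → ((m ∸ 1) * N < wt m X) × (wt m X ≤ m * N)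
proposition4p6 zero          _ _       _ p-prime = ⊥-elim (¬prime[0] p-prime)
proposition4p6 (suc zero)    _ _       _ p-prime = ⊥-elim (¬prime[1] p-prime)
proposition4p6 (suc (suc k)) s (suc n) N _ s≥1 _ _ q∣N _ X extremal =
  subst₂ (λ S W → n * S < W × W ≤ suc n * S) ∑x≡N (sym wt≡)
    (weighted-sum-bounds (extend X) n (∑∑<last k s {{>-nonZero s≥1}} n X∈V extremal q∣N))
  where
  X∈V = [ proj₁ , proj₁ ]′ extremal
  ∑x≡N : ∑< (extend X) (suc n) ≡ N
  ∑x≡N = trans (sym (sumF≡∑<-extend (suc n) X (λ _ a → a))) (proj₁ (proj₂ X∈V))
  wt≡ : wt (suc n) X ≡ ∑< (λ i → suc i * extend X i) (suc n)
  wt≡ = sumF≡∑<-extend (suc n) X (λ i a → suc i * a)
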